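{- Let $I$ be a finite set of positive integers, $r \geq 0$, and $A, A', A'' \subseteq \mathbb{F}_2^I$. Then \[ |A + A' + A'' + H_r(I)| \geq \min\Big( \tfrac12 (2+\sqrt{5})^{r/3} |A|^{1/3}|A'|^{1/3}|A''|^{1/3},\ 2^{|I|} \Big). \]
   Context: $\mathbb{F}_2^I$ is the vector space of tuples $(x_i)_{i\in I}$ over $\mathbb{F}_2$. The Hamming norm $\|x\|$ is the number of $i$ with $x_i=1$, and $H_r(I):=\{x\in\mathbb{F}_2^I:\|x\|\le r\}$. Sumsets are $X+Y=\{x+y:x\in X,y\in Y\}$. -}

module Defs where

open import Data.Bool using (Bool; true; false; _∧_; _xor_; if_then_else_)
open import Data.Nat using (ℕ; zero; suc; _+_; _*_; _∸_; _≤_; _≤ᵇ_)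
open import Data.Product using (_×_; _,_)
open import Data.List using (List; []; _∷_; map; _++_; length; filterᵇ)
open import Data.Bool.ListAction using (any)
open import Data.Vec using (Vec; []; _∷_; zipWith)

-- Points of F_2^I, with |I| = n (identify I with an n-element index set).
F2 : ℕ → Set
F2 n = Vec Bool n

_⊕_ : ∀ {n} → F2 n → F2 n → F2 n
_⊕_ = zipWith _xor_

eqᵇ : ∀ {n} → F2 n → F2 n → Bool
eqᵇ [] [] = true
eqᵇ (x ∷ xs) (y ∷ ys) = (if x then y else (if y then false else true)) ∧ eqᵇ xs ys

allVecs : (n : ℕ) → List (F2 n)
allVecs zero = [] ∷ []
allVecs (suc n) = map (true ∷_) (allVecs n) ++ map (false ∷_) (allVecs n)

Subset2 : ℕ → Set
Subset2 n = F2 n → Bool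

card : ∀ {n} → Subset2 n → ℕ
card {n} X = length (filterᵇ X (allVecs n))

_+ˢ_ : ∀ {n} → Subset2 n → Subset2 n → Subset2 n
_+ˢ_ {n} X Y v = any (λ x → any (λ y → X x ∧ (Y y ∧ eqᵇ (x ⊕ y) v)) (allVecs n)) (allVecs n)

norm : ∀ {n} → F2 n → ℕ
norm [] = 0
norm (true ∷ xs) = suc (norm xs)
norm (false ∷ xs) = norm xs

H : (n r : ℕ) → Subset2 n
H n r x = norm x ≤ᵇ r

-- (2 + √5)^r = a + b √5, returned as (a , b).
pow2√5 : ℕ → ℕ × ℕ
pow2√5 zero = 1 , 0
pow2√5 (suc r) with pow2√5 r
... | a , b = (2 * a + 5 * b) , (a + 2 * b)

-- The real inequality  a + b·√5 ≤ N  (a, b, N natural), stated exactly: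
-- a ≤ N and 5 b² ≤ (N − a)².
_+_√5≤_ : ℕ → ℕ → ℕ → Set
a + b √5≤ N = (a ≤ N) × (5 * b * b ≤ (N ∸ a) * (N ∸ a))

{-# OPTIONS --safe #-}
module Submission where

-- Write φ = 2 + √5 and induct on the dimension.  Split F₂ⁿ⁺¹ by the first coordinate, let
-- a, b, c be the sizes of the larger halves of A, A′, A″ and a′ ≤ a, b′ ≤ b, c′ ≤ c those of the
-- smaller ones, and let u, v be the sizes of the two slices of S = A + A′ + A″ + H_r.  One slice
-- contains the sum of the larger halves with H_r(n); the other contains their sum with H_{r−1}(n)
-- and the three sums with H_r(n) in which one larger half is replaced by the smaller one.  Unless
-- one of these sums is all of F₂ⁿ, induction gives φʳ abc ≤ 8u³ and, with t = 8v³/φʳ,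
-- a′bc, ab′c, abc′ ≤ t and abc ≤ φt.  Then Π = (a + a′)(b + b′)(c + c′) is at most 8abc, and at
-- most 8t: directly if abc ≤ t, and otherwise because
--   (abc)² Π = (abc + a′bc)(abc + ab′c)(abc + abc′) ≤ (abc + t)³ ≤ 8t(abc)²,
-- the last step being (1 + x)³ ≤ 8x² for 1 ≤ x ≤ φ.  Hence φʳ Π ≤ 8(2 min(u, v))³ ≤ 8|S|³.
-- For r = 0 it suffices that |A|, |A′|, |A″| ≤ |S|.  All comparisons involving φ are made
-- exactly in the ordered ring ℤ[√5].

open import Defs

module ℤ[√5] where

  open import Algebra.Bundles using (CommutativeRing)
  open import Data.Empty using (⊥-elim)
  open import Data.Integer.Base as ℤ using (ℤ; +_; -[1+_]; 0ℤ)
  import Data.Integer.Properties as ℤ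
  import Data.Integer.Tactic.RingSolver as ℤ-Solver
  open import Data.List.Base using ([]; _∷_)
  open import Data.Maybe.Base using (just; nothing)
  open import Data.Nat.Base as ℕ using (ℕ; zero; suc; z≤n; s≤s)
  open import Data.Nat.Divisibility using (_∣_; divides)
  open import Data.Nat.Induction using (<-rec)
  open import Data.Nat.Primality using (prime?; euclidsLemma)
  import Data.Nat.Properties as ℕ
  import Data.Nat.Tactic.RingSolver as ℕ-Solver
  open import Data.Product.Base using (_×_; _,_; proj₁; proj₂)
  open import Data.Sum.Base as Sum using (_⊎_; inj₁; inj₂; [_,_]′)
  open import Function.Base using (id; _$_; _∘_)
  open import Level using (0ℓ)
  open import Relation.Binary.Bundles using (Poset)
  import Relation.Binary.Reasoning.PartialOrder as PartialOrderReasoning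
  open import Relation.Binary.PropositionalEquality
  open import Relation.Nullary.Decidable using (from-yes)
  import Tactic.RingSolver.Core.AlmostCommutativeRing as ACR
  open import Tactic.RingSolver using (solve-∀)

  -- The ring ℤ[√5]

  private
    module ℤ-Identities where
      open import Data.Integer.Base using (_+_; _*_; _-_; -_)

      re-assoc : ∀ a b c d e f → (a * c + + 5 * (b * d)) * e + + 5 * ((a * d + b * c) * f)
                                ≡ a * (c * e + + 5 * (d * f)) + + 5 * (b * (c * f + d * e))
      re-assoc = ℤ-Solver.solve-∀

      im-assoc : ∀ a b c d e f → (a * c + + 5 * (b * d)) * f + (a * d + b * c) * e
                                ≡ a * (c * f + d * e) + b * (c * e + + 5 * (d * f))
      im-assoc = ℤ-Solver.solve-∀

      re-distrib : ∀ a b c d e f → (c + e) * a + + 5 * ((d + f) * b)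
                                  ≡ (c * a + + 5 * (d * b)) + (e * a + + 5 * (f * b))
      re-distrib = ℤ-Solver.solve-∀

      im-distrib : ∀ a b c d e f → (c + e) * b + (d + f) * a ≡ (c * b + d * a) + (e * b + f * a)
      im-distrib = ℤ-Solver.solve-∀

      brahmagupta : ∀ x y u v → (x * u + + 5 * (y * v)) * (x * u + + 5 * (y * v))
                                  - + 5 * ((x * v + y * u) * (x * v + y * u))
                                ≡ (x * x - + 5 * (y * y)) * (u * u - + 5 * (v * v))
      brahmagupta = ℤ-Solver.solve-∀

      norm-+ : ∀ x y u v → (x + u) * (x + u) - + 5 * ((y + v) * (y + v))
                           ≡ (x * x - + 5 * (y * y)) + (u * u - + 5 * (v * v)) + + 2 * (x * u - + 5 * (y * v))
      norm-+ = ℤ-Solver.solve-∀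

      cross-squares : ∀ x y u v → x * u * (x * u) - + 5 * (y * v) * (+ 5 * (y * v))
                                  ≡ (x * x - + 5 * (y * y)) * (u * u) + + 5 * (y * y) * (u * u - + 5 * (v * v))
      cross-squares = ℤ-Solver.solve-∀

      neg-square : ∀ a → - a * - a ≡ a * a
      neg-square = ℤ-Solver.solve-∀

  infix 5 _∔_√5
  record ℤ√5 : Set where
    constructor _∔_√5
    field
      re im : ℤ
  open ℤ√5

  open import Algebra.Consequences.Propositional {A = ℤ√5}
  open import Algebra.Definitions {A = ℤ√5} _≡_

  infixl 6 _+_ _-_
  infixl 7 _*_
  infix 8 -_
  infixr 8 _^_

  _+_ : ℤ√5 → ℤ√5 → ℤ√5
  (a ∔ b √5) + (c ∔ d √5) = (a ℤ.+ c) ∔ (b ℤ.+ d) √5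

  _*_ : ℤ√5 → ℤ√5 → ℤ√5
  (a ∔ b √5) * (c ∔ d √5) = (a ℤ.* c ℤ.+ + 5 ℤ.* (b ℤ.* d)) ∔ (a ℤ.* d ℤ.+ b ℤ.* c) √5

  -- Defined through the projections rather than by matching, so that the ring solver recognises -_.
  -_ : ℤ√5 → ℤ√5
  - z = ℤ.- re z ∔ ℤ.- im z √5

  _-_ : ℤ√5 → ℤ√5 → ℤ√5
  z - w = z + - w

  -- φ = 2 + √5 and its inverse ψ = √5 − 2
  0# 1# √5 φ ψ : ℤ√5
  0# = 0ℤ ∔ 0ℤ √5
  1# = + 1 ∔ 0ℤ √5
  √5 = 0ℤ ∔ + 1 √5
  φ = + 2 ∔ + 1 √5
  ψ = -[1+ 1 ] ∔ + 1 √5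

  ι : ℕ → ℤ√5
  ι n = + n ∔ 0ℤ √5

  _^_ : ℤ√5 → ℕ → ℤ√5
  z ^ zero = 1#
  z ^ suc n = z * z ^ n

  +-assoc : Associative _+_
  +-assoc (a ∔ b √5) (c ∔ d √5) (e ∔ f √5) = cong₂ _∔_√5 (ℤ.+-assoc a c e) (ℤ.+-assoc b d f)

  +-comm : Commutative _+_
  +-comm (a ∔ b √5) (c ∔ d √5) = cong₂ _∔_√5 (ℤ.+-comm a c) (ℤ.+-comm b d)

  +-identity : Identity 0# _+_
  +-identity = comm∧idˡ⇒id +-comm λ where
    (a ∔ b √5) → cong₂ _∔_√5 (ℤ.+-identityˡ a) (ℤ.+-identityˡ b)

  -‿inverse : Inverse 0# -_ _+_
  -‿inverse = comm∧invˡ⇒inv +-comm λ where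
    (a ∔ b √5) → cong₂ _∔_√5 (ℤ.+-inverseˡ a) (ℤ.+-inverseˡ b)

  *-comm : Commutative _*_
  *-comm (a ∔ b √5) (c ∔ d √5) =
    cong₂ _∔_√5 (ℤ-Solver.solve (a ∷ b ∷ c ∷ d ∷ [])) (ℤ-Solver.solve (a ∷ b ∷ c ∷ d ∷ []))

  *-identity : Identity 1# _*_
  *-identity = comm∧idˡ⇒id *-comm λ where
    (a ∔ b √5) → cong₂ _∔_√5 (ℤ-Solver.solve (a ∷ b ∷ [])) (ℤ-Solver.solve (a ∷ b ∷ []))

  *-assoc : Associative _*_
  *-assoc (a ∔ b √5) (c ∔ d √5) (e ∔ f √5) =
    cong₂ _∔_√5 (ℤ-Identities.re-assoc a b c d e f) (ℤ-Identities.im-assoc a b c d e f)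

  *-distribʳ-+ : _*_ DistributesOverʳ _+_
  *-distribʳ-+ (a ∔ b √5) (c ∔ d √5) (e ∔ f √5) =
    cong₂ _∔_√5 (ℤ-Identities.re-distrib a b c d e f) (ℤ-Identities.im-distrib a b c d e f)

  commutativeRing : CommutativeRing 0ℓ 0ℓ
  commutativeRing = record
    { isCommutativeRing = record
      { isRing = record
        { +-isAbelianGroup = record
          { isGroup = record
            { isMonoid = record
              { isSemigroup = record
                { isMagma = record { isEquivalence = isEquivalence ; ∙-cong = cong₂ _+_ }
                ; assoc = +-assoc }
              ; identity = +-identity }
            ; inverse = -‿inverse
            ; ⁻¹-cong = cong (-_) }
          ; comm = +-comm }
        ; *-cong = cong₂ _*_
        ; *-assoc = *-assoc
        ; *-identity = *-identity
        ; distrib = comm∧distrʳ⇒distrˡ *-comm *-distribʳ-+ , *-distribʳ-+ }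
      ; *-comm = *-comm } }

  open import Algebra.Properties.Ring (CommutativeRing.ring commutativeRing) using (-‿involutive)
  open CommutativeRing commutativeRing using (distribˡ; +-identityˡ; +-identityʳ; *-identityˡ; -‿inverseʳ)
  open import Algebra.Properties.Group (CommutativeRing.+-group commutativeRing) using (x∙y⁻¹≈ε⇒x≈y)

  ring : ACR.AlmostCommutativeRing 0ℓ 0ℓ
  ring = ACR.fromCommutativeRing commutativeRing λ where
    (+ 0 ∔ + 0 √5) → just refl
    _ → nothing

  -- The order of ℤ[√5]

  private
    0≤-* : ∀ {a b} → 0ℤ ℤ.≤ a → 0ℤ ℤ.≤ b → 0ℤ ℤ.≤ a ℤ.* b
    0≤-* {+ m} {+ n} _ _ = subst (0ℤ ℤ.≤_) (ℤ.pos-* m n) (ℤ.+≤+ z≤n)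

    0≤-*-cancel : ∀ c a → 0ℤ ℤ.< c → 0ℤ ℤ.≤ c ℤ.* a → 0ℤ ℤ.≤ a
    0≤-*-cancel (+ suc _) (+ _) _ _ = ℤ.+≤+ z≤n
    0≤-*-cancel (+ suc _) -[1+ _ ] _ ()
    0≤-*-cancel (+ 0) _ (ℤ.+<+ ()) _

    0≤-square : ∀ a → 0ℤ ℤ.≤ a ℤ.* a
    0≤-square (+ n) = 0≤-* {+ n} {+ n} (ℤ.+≤+ z≤n) (ℤ.+≤+ z≤n)
    0≤-square -[1+ n ] = ℤ.+≤+ z≤n

    ≤-of-squares : ∀ {a b} → 0ℤ ℤ.≤ b → a ℤ.* a ℤ.≤ b ℤ.* b → a ℤ.≤ b
    ≤-of-squares { -[1+ _ ]} (ℤ.+≤+ _) _ = ℤ.-≤+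
    ≤-of-squares {+ m} {+ n} _ m²≤n² = ℤ.+≤+ (ℕ.≮⇒≥ λ n<m →
      ℕ.<⇒≱ (ℕ.*-mono-< n<m n<m) (ℤ.drop‿+≤+ (subst₂ ℤ._≤_ (sym (ℤ.pos-* m m)) (sym (ℤ.pos-* n n)) m²≤n²)))

    0≤b∓a : ∀ {a b} → 0ℤ ℤ.≤ b → a ℤ.* a ℤ.≤ b ℤ.* b → 0ℤ ℤ.≤ b ℤ.- a × 0ℤ ℤ.≤ b ℤ.+ a
    0≤b∓a {a} {b} 0≤b a²≤b² =
      ℤ.i≤j⇒0≤j-i (≤-of-squares 0≤b a²≤b²) ,
      subst (0ℤ ℤ.≤_) (cong (ℤ._+_ b) (ℤ.neg-involutive a))
        (ℤ.i≤j⇒0≤j-i (≤-of-squares 0≤b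
          (subst (ℤ._≤ b ℤ.* b) (sym (ℤ-Identities.neg-square a)) a²≤b²)))

    0≤-5* : ∀ {a} → a ℤ.≤ 0ℤ → 0ℤ ℤ.≤ ℤ.- + 5 ℤ.* a
    0≤-5* { -[1+ _ ]} _ = ℤ.+≤+ z≤n
    0≤-5* {+ 0} _ = ℤ.+≤+ z≤n
    0≤-5* {+ suc _} (ℤ.+≤+ ())

    0≤-5*⇒≡0 : ∀ {a} → 0ℤ ℤ.≤ a → 0ℤ ℤ.≤ ℤ.- + 5 ℤ.* a → a ≡ 0ℤ
    0≤-5*⇒≡0 {+ 0} _ _ = refl

    5∣-square : ∀ m → 5 ∣ m ℕ.* m → 5 ∣ m
    5∣-square m 5∣m² with euclidsLemma m m (from-yes (prime? 5)) 5∣m²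
    ... | inj₁ 5∣m = 5∣m
    ... | inj₂ 5∣m = 5∣m

  √5-irrational : ∀ m n → m ℕ.* m ≡ 5 ℕ.* (n ℕ.* n) → n ≡ 0
  √5-irrational = <-rec _ descent
    where
    descent : ∀ m → (∀ {k} → k ℕ.< m → ∀ n → k ℕ.* k ≡ 5 ℕ.* (n ℕ.* n) → n ≡ 0) →
              ∀ n → m ℕ.* m ≡ 5 ℕ.* (n ℕ.* n) → n ≡ 0
    descent m rec zero _ = refl
    descent m rec n@(suc _) m²≡5n² with 5∣-square m (divides (n ℕ.* n) (trans m²≡5n² (ℕ.*-comm 5 _)))
    ... | divides q refl
      with rec n<m q (ℕ.*-cancelˡ-≡ _ _ 5 (trans (sym m²≡5n²) (ℕ-Solver.solve (q ∷ []))))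
      where
      n<m : n ℕ.< q ℕ.* 5
      n<m = ℕ.≰⇒> λ m≤n → ℕ.<-irrefl (trans m²≡5n² (ℕ.*-comm 5 _))
              (ℕ.≤-<-trans (ℕ.*-mono-≤ m≤n m≤n) (ℕ.m<m*n (n ℕ.* n) 5 (s≤s (s≤s z≤n))))
    ... | refl = ⊥-elim (ℕ.0≢1+n m²≡5n²)

  Nm : ℤ√5 → ℤ
  Nm (x ∔ y √5) = x ℤ.* x ℤ.- + 5 ℤ.* (y ℤ.* y)

  Nm-* : ∀ z w → Nm (z * w) ≡ Nm z ℤ.* Nm w
  Nm-* (x ∔ y √5) (u ∔ v √5) = ℤ-Identities.brahmagupta x y u v

  Nm-neg : ∀ z → Nm (- z) ≡ Nm z
  Nm-neg (x ∔ y √5) = cong₂ (λ a b → a ℤ.- + 5 ℤ.* b) (ℤ-Identities.neg-square x) (ℤ-Identities.neg-square y)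

  Nm≡0⇒≡0 : ∀ z → Nm z ≡ 0ℤ → z ≡ 0#
  Nm≡0⇒≡0 (x ∔ y √5) Nm≡0 = cong₂ _∔_√5 (ℤ.∣i∣≡0⇒i≡0 ∣x∣≡0) (ℤ.∣i∣≡0⇒i≡0 ∣y∣≡0)
    where
    ∣x∣²≡5∣y∣² : ℤ.∣ x ∣ ℕ.* ℤ.∣ x ∣ ≡ 5 ℕ.* (ℤ.∣ y ∣ ℕ.* ℤ.∣ y ∣)
    ∣x∣²≡5∣y∣² = begin
      ℤ.∣ x ∣ ℕ.* ℤ.∣ x ∣            ≡⟨ ℤ.abs-* x x ⟨
      ℤ.∣ x ℤ.* x ∣                  ≡⟨ cong ℤ.∣_∣ (ℤ.i-j≡0⇒i≡j (x ℤ.* x) _ Nm≡0) ⟩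
      ℤ.∣ + 5 ℤ.* (y ℤ.* y) ∣        ≡⟨ ℤ.abs-* (+ 5) (y ℤ.* y) ⟩
      5 ℕ.* ℤ.∣ y ℤ.* y ∣            ≡⟨ cong (5 ℕ.*_) (ℤ.abs-* y y) ⟩
      5 ℕ.* (ℤ.∣ y ∣ ℕ.* ℤ.∣ y ∣)    ∎
      where open ≡-Reasoning
    ∣y∣≡0 : ℤ.∣ y ∣ ≡ 0
    ∣y∣≡0 = √5-irrational ℤ.∣ x ∣ ℤ.∣ y ∣ ∣x∣²≡5∣y∣²
    ∣x∣≡0 : ℤ.∣ x ∣ ≡ 0
    ∣x∣≡0 = [ id , id ]′ (ℕ.m*n≡0⇒m≡0∨n≡0 ℤ.∣ x ∣
              (trans ∣x∣²≡5∣y∣² (cong (λ k → 5 ℕ.* (k ℕ.* k)) ∣y∣≡0)))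

  record Dominant (z : ℤ√5) : Set where
    constructor dominant
    field
      0≤re : 0ℤ ℤ.≤ re z
      0≤Nm : 0ℤ ℤ.≤ Nm z

  Dominant-cross : ∀ {x y u v} → Dominant (x ∔ y √5) → Dominant (u ∔ v √5) →
                   0ℤ ℤ.≤ x ℤ.* u ℤ.- + 5 ℤ.* (y ℤ.* v) × 0ℤ ℤ.≤ x ℤ.* u ℤ.+ + 5 ℤ.* (y ℤ.* v)
  Dominant-cross {x} {y} {u} {v} (dominant 0≤x 0≤Nz) (dominant 0≤u 0≤Nw) = 0≤b∓a (0≤-* 0≤x 0≤u) [5yv]²≤[xu]²
    where
    [5yv]²≤[xu]² : + 5 ℤ.* (y ℤ.* v) ℤ.* (+ 5 ℤ.* (y ℤ.* v)) ℤ.≤ x ℤ.* u ℤ.* (x ℤ.* u)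
    [5yv]²≤[xu]² = ℤ.0≤i-j⇒j≤i (subst (0ℤ ℤ.≤_) (sym (ℤ-Identities.cross-squares x y u v))
      (ℤ.+-mono-≤ (0≤-* 0≤Nz (0≤-square u)) (0≤-* (0≤-* {+ 5} (ℤ.+≤+ z≤n) (0≤-square y)) 0≤Nw)))

  Dominant-+ : ∀ {z w} → Dominant z → Dominant w → Dominant (z + w)
  Dominant-+ {x ∔ y √5} {u ∔ v √5} dz@(dominant 0≤x 0≤Nz) dw@(dominant 0≤u 0≤Nw) = dominant
    (ℤ.+-mono-≤ 0≤x 0≤u)
    (subst (0ℤ ℤ.≤_) (sym (ℤ-Identities.norm-+ x y u v))
      (ℤ.+-mono-≤ (ℤ.+-mono-≤ 0≤Nz 0≤Nw) (0≤-* {+ 2} (ℤ.+≤+ z≤n) (proj₁ (Dominant-cross dz dw)))))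

  Dominant-* : ∀ {z w} → Dominant z → Dominant w → Dominant (z * w)
  Dominant-* {z@(_ ∔ _ √5)} {w@(_ ∔ _ √5)} dz dw = dominant
    (proj₂ (Dominant-cross dz dw))
    (subst (0ℤ ℤ.≤_) (sym (Nm-* z w)) (0≤-* (Dominant.0≤Nm dz) (Dominant.0≤Nm dw)))

  Dominant-cancel : ∀ k {z} → Dominant (ι (suc k) * z) → Dominant z
  Dominant-cancel k {z@(x ∔ _ √5)} (dominant 0≤re 0≤Nm) = dominant
    (0≤-*-cancel (+ suc k) x (ℤ.+<+ ℕ.z<s) (subst (0ℤ ℤ.≤_) (ℤ.+-identityʳ (+ suc k ℤ.* x)) 0≤re))
    (0≤-*-cancel (Nm (ι (suc k))) (Nm z) (ℤ.+<+ ℕ.z<s) (subst (0ℤ ℤ.≤_) (Nm-* (ι (suc k)) z) 0≤Nm))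

  Dominant-or-neg : ∀ z → 0ℤ ℤ.≤ Nm z → Dominant z ⊎ Dominant (- z)
  Dominant-or-neg (+ _ ∔ _ √5) 0≤Nm = inj₁ (dominant (ℤ.+≤+ z≤n) 0≤Nm)
  Dominant-or-neg z@(-[1+ _ ] ∔ _ √5) 0≤Nm =
    inj₂ (dominant (ℤ.+≤+ z≤n) (subst (0ℤ ℤ.≤_) (sym (Nm-neg z)) 0≤Nm))

  Dominant-antisym : ∀ {z} → Dominant z → Dominant (- z) → z ≡ 0#
  Dominant-antisym {+ 0 ∔ + 0 √5} _ _ = refl
  Dominant-antisym {+ 0 ∔ + suc _ √5} (dominant _ ()) _
  Dominant-antisym {+ 0 ∔ -[1+ _ ] √5} (dominant _ ()) _
  Dominant-antisym {+ suc _ ∔ _ √5} _ (dominant () _)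
  Dominant-antisym { -[1+ _ ] ∔ _ √5} (dominant () _) _

  Dominant-antisym-√5 : ∀ {z} → Dominant z → Dominant (√5 * - z) → z ≡ 0#
  Dominant-antisym-√5 {z} (dominant _ 0≤Nz) (dominant _ 0≤N[√5-z]) = Nm≡0⇒≡0 z (0≤-5*⇒≡0 0≤Nz
    (subst (0ℤ ℤ.≤_) (trans (Nm-* √5 (- z)) (cong (ℤ.- + 5 ℤ.*_) (Nm-neg z))) 0≤N[√5-z]))

  √5-neg : ∀ z → - (√5 * z) ≡ √5 * - z
  √5-neg = solve-∀ ring

  -- x + y√5 ≥ 0 iff x ≥ √5|y| (Dominant z) or √5 y ≥ |x| (Dominant (√5 * z), where
  -- √5 * z = 5y + x√5).
  data NonNeg (z : ℤ√5) : Set where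
    re-dominant : Dominant z → NonNeg z
    im-dominant : Dominant (√5 * z) → NonNeg z

  NonNeg-total : ∀ z → NonNeg z ⊎ NonNeg (- z)
  NonNeg-total z with ℤ.≤-total 0ℤ (Nm z)
  ... | inj₁ 0≤Nz = Sum.map re-dominant re-dominant (Dominant-or-neg z 0≤Nz)
  ... | inj₂ Nz≤0 = Sum.map im-dominant (im-dominant ∘ subst Dominant (√5-neg z))
                      (Dominant-or-neg (√5 * z) (subst (0ℤ ℤ.≤_) (sym (Nm-* √5 z)) (0≤-5* Nz≤0)))

  NonNeg-antisym : ∀ {z} → NonNeg z → NonNeg (- z) → z ≡ 0#
  NonNeg-antisym (re-dominant d) (re-dominant d′) = Dominant-antisym d d′
  NonNeg-antisym (re-dominant d) (im-dominant d′) = Dominant-antisym-√5 d d′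
  NonNeg-antisym {z} (im-dominant d) (re-dominant d′) =
    trans (sym (-‿involutive z))
      (cong -_ (Dominant-antisym-√5 d′ (subst (λ w → Dominant (√5 * w)) (sym (-‿involutive z)) d)))
  NonNeg-antisym {z} (im-dominant d) (im-dominant d′) =
    Nm≡0⇒≡0 z (ℤ.*-cancelˡ-≡ (ℤ.- + 5) (Nm z) 0ℤ (trans (sym (Nm-* √5 z)) (cong Nm √5z≡0)))
    where
    √5z≡0 : √5 * z ≡ 0#
    √5z≡0 = Dominant-antisym d (subst Dominant (sym (√5-neg z)) d′)

  -- Were z + w negative, adding z (resp. √5 * w) to −(z + w) would stay within one kind of Dominant
  -- and show −w ≥ 0 (resp. −z ≥ 0), so w = 0 (resp. z = 0) by antisymmetry.
  NonNeg-+-mixed : ∀ {z w} → Dominant z → Dominant (√5 * w) → NonNeg (z + w)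
  NonNeg-+-mixed {z} {w} dz d√5w with NonNeg-total (z + w)
  ... | inj₁ 0≤z+w = 0≤z+w
  ... | inj₂ (re-dominant d) = subst NonNeg (sym (trans (cong (_+_ z) w≡0) (+-identityʳ z))) (re-dominant dz)
    where
    cancel : ∀ z w → z + - (z + w) ≡ - w
    cancel = solve-∀ ring
    w≡0 : w ≡ 0#
    w≡0 = NonNeg-antisym (im-dominant d√5w) (re-dominant (subst Dominant (cancel z w) (Dominant-+ dz d)))
  ... | inj₂ (im-dominant d) =
    subst NonNeg (sym (trans (cong (λ u → u + w) z≡0) (+-identityˡ w))) (im-dominant d√5w)
    where
    cancel : ∀ z w → √5 * w + √5 * - (z + w) ≡ √5 * - z
    cancel = solve-∀ ring
    z≡0 : z ≡ 0#
    z≡0 = NonNeg-antisym (re-dominant dz) (im-dominant (subst Dominant (cancel z w) (Dominant-+ d√5w d)))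

  NonNeg-+ : ∀ {z w} → NonNeg z → NonNeg w → NonNeg (z + w)
  NonNeg-+ (re-dominant dz) (re-dominant dw) = re-dominant (Dominant-+ dz dw)
  NonNeg-+ {z} {w} (im-dominant dz) (im-dominant dw) =
    im-dominant (subst Dominant (sym (distribˡ √5 z w)) (Dominant-+ dz dw))
  NonNeg-+ (re-dominant dz) (im-dominant dw) = NonNeg-+-mixed dz dw
  NonNeg-+ {z} {w} (im-dominant dz) (re-dominant dw) = subst NonNeg (+-comm w z) (NonNeg-+-mixed dw dz)

  NonNeg-* : ∀ {z w} → NonNeg z → NonNeg w → NonNeg (z * w)
  NonNeg-* (re-dominant dz) (re-dominant dw) = re-dominant (Dominant-* dz dw)
  NonNeg-* {z} {w} (re-dominant dz) (im-dominant dw) = im-dominant (subst Dominant (commute z w) (Dominant-* dz dw))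
    where
    commute : ∀ z w → z * (√5 * w) ≡ √5 * (z * w)
    commute = solve-∀ ring
  NonNeg-* {z} {w} (im-dominant dz) (re-dominant dw) =
    im-dominant (subst Dominant (*-assoc √5 z w) (Dominant-* dz dw))
  NonNeg-* {z} {w} (im-dominant dz) (im-dominant dw) =
    re-dominant (Dominant-cancel 4 (subst Dominant (√5²-factor z w) (Dominant-* dz dw)))
    where
    √5²-factor : ∀ z w → √5 * z * (√5 * w) ≡ ι 5 * (z * w)
    √5²-factor = solve-∀ ring

  NonNeg-cancel : ∀ k {z} → NonNeg (ι (suc k) * z) → NonNeg z
  NonNeg-cancel k (re-dominant d) = re-dominant (Dominant-cancel k d)
  NonNeg-cancel k {z} (im-dominant d) = im-dominant (Dominant-cancel k (subst Dominant (commute (ι (suc k)) z) d))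
    where
    commute : ∀ c z → √5 * (c * z) ≡ c * (√5 * z)
    commute = solve-∀ ring

  NonNeg-ι : ∀ n → NonNeg (ι n)
  NonNeg-ι n =
    re-dominant (dominant (ℤ.+≤+ z≤n) (subst (0ℤ ℤ.≤_) (sym (ℤ.+-identityʳ (+ n ℤ.* + n))) (0≤-square (+ n))))

  NonNeg-√5 : NonNeg √5
  NonNeg-√5 = im-dominant (dominant (ℤ.+≤+ z≤n) (ℤ.+≤+ z≤n))

  NonNeg-ψ : NonNeg ψ
  NonNeg-ψ = im-dominant (dominant (ℤ.+≤+ z≤n) (ℤ.+≤+ z≤n))

  NonNeg-φ : NonNeg φ
  NonNeg-φ = im-dominant (dominant (ℤ.+≤+ z≤n) (ℤ.+≤+ z≤n))

  NonNeg-^ : ∀ {z} n → NonNeg z → NonNeg (z ^ n)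
  NonNeg-^ zero _ = NonNeg-ι 1
  NonNeg-^ (suc n) 0≤z = NonNeg-* 0≤z (NonNeg-^ n 0≤z)

  ι-+ : ∀ m n → ι (m ℕ.+ n) ≡ ι m + ι n
  ι-+ m n = cong₂ _∔_√5 (ℤ.pos-+ m n) refl

  ι-* : ∀ m n → ι (m ℕ.* n) ≡ ι m * ι n
  ι-* m n = cong₂ _∔_√5 (trans (ℤ.pos-* m n) (sym (ℤ.+-identityʳ _))) (sym (cong₂ ℤ._+_ (ℤ.*-zeroʳ (+ m)) refl))

  ι-injective : ∀ {m n} → ι m ≡ ι n → m ≡ n
  ι-injective = ℤ.+-injective ∘ cong re

  infix 4 _≤_
  record _≤_ (x y : ℤ√5) : Set where
    constructor mk≤
    field
      diff-nonneg : NonNeg (y - x)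
  open _≤_

  ≤-reflexive : ∀ {x y} → x ≡ y → x ≤ y
  ≤-reflexive {x} refl = mk≤ (subst NonNeg (sym (-‿inverseʳ x)) (NonNeg-ι 0))

  ≤-trans : ∀ {x y z} → x ≤ y → y ≤ z → x ≤ z
  ≤-trans {x} {y} {z} (mk≤ 0≤y-x) (mk≤ 0≤z-y) = mk≤ (subst NonNeg (telescope x y z) (NonNeg-+ 0≤z-y 0≤y-x))
    where
    telescope : ∀ x y z → (z - y) + (y - x) ≡ z - x
    telescope = solve-∀ ring

  ≤-antisym : ∀ {x y} → x ≤ y → y ≤ x → x ≡ y
  ≤-antisym {x} {y} (mk≤ 0≤y-x) (mk≤ 0≤x-y) =
    sym (x∙y⁻¹≈ε⇒x≈y y x (NonNeg-antisym 0≤y-x (subst NonNeg (flip x y) 0≤x-y)))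
    where
    flip : ∀ x y → x - y ≡ - (y - x)
    flip = solve-∀ ring

  ≤-total : ∀ x y → x ≤ y ⊎ y ≤ x
  ≤-total x y = Sum.map mk≤ (mk≤ ∘ subst NonNeg (flip x y)) (NonNeg-total (y - x))
    where
    flip : ∀ x y → - (y - x) ≡ x - y
    flip = solve-∀ ring

  ≤-poset : Poset 0ℓ 0ℓ 0ℓ
  ≤-poset = record
    { isPartialOrder = record
      { isPreorder = record { isEquivalence = isEquivalence ; reflexive = ≤-reflexive ; trans = ≤-trans }
      ; antisym = ≤-antisym } }

  module ≤-Reasoning = PartialOrderReasoning ≤-poset

  NonNeg-mono : ∀ {x y} → x ≤ y → NonNeg x → NonNeg y
  NonNeg-mono {x} {y} (mk≤ 0≤y-x) 0≤x = subst NonNeg (cancel x y) (NonNeg-+ 0≤y-x 0≤x)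
    where
    cancel : ∀ x y → y - x + x ≡ y
    cancel = solve-∀ ring

  *-monoˡ-≤ : ∀ {k x y} → NonNeg k → x ≤ y → k * x ≤ k * y
  *-monoˡ-≤ {k} {x} {y} 0≤k (mk≤ 0≤y-x) = mk≤ (subst NonNeg (distrib k x y) (NonNeg-* 0≤k 0≤y-x))
    where
    distrib : ∀ k x y → k * (y - x) ≡ k * y - k * x
    distrib = solve-∀ ring

  *-cancelˡ-≤ : ∀ k {x y} → ι (suc k) * x ≤ ι (suc k) * y → x ≤ y
  *-cancelˡ-≤ k {x} {y} (mk≤ 0≤cy-cx) = mk≤ (NonNeg-cancel k (subst NonNeg (distrib (ι (suc k)) x y) 0≤cy-cx))
    where
    distrib : ∀ c x y → c * y - c * x ≡ c * (y - x)
    distrib = solve-∀ ring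

  ι-mono-≤ : ∀ {m n} → m ℕ.≤ n → ι m ≤ ι n
  ι-mono-≤ {m} {n} m≤n = mk≤ (subst NonNeg ι[n∸m]≡ιn-ιm (NonNeg-ι (n ℕ.∸ m)))
    where
    cancel : ∀ a b → a ≡ (a + b) - b
    cancel = solve-∀ ring
    ι[n∸m]≡ιn-ιm : ι (n ℕ.∸ m) ≡ ι n - ι m
    ι[n∸m]≡ιn-ιm =
      trans (cancel _ (ι m)) (cong (_- ι m) (trans (sym (ι-+ (n ℕ.∸ m) m)) (cong ι (ℕ.m∸n+n≡m m≤n))))

  ι-cancel-≤ : ∀ {m n} → ι m ≤ ι n → m ℕ.≤ n
  ι-cancel-≤ {m} {n} ιm≤ιn with ℕ.≤-total m n
  ... | inj₁ m≤n = m≤n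
  ... | inj₂ n≤m = ℕ.≤-reflexive (ι-injective (≤-antisym ιm≤ιn (ι-mono-≤ n≤m)))

  *-monoʳ-≤ : ∀ {k x y} → NonNeg k → x ≤ y → x * k ≤ y * k
  *-monoʳ-≤ {k} {x} {y} 0≤k x≤y = subst₂ _≤_ (*-comm k x) (*-comm k y) (*-monoˡ-≤ 0≤k x≤y)

  square-mono-≤ : ∀ {x y} → NonNeg x → x ≤ y → x * x ≤ y * y
  square-mono-≤ 0≤x x≤y = ≤-trans (*-monoˡ-≤ 0≤x x≤y) (*-monoʳ-≤ (NonNeg-mono x≤y 0≤x) x≤y)

  -- The numerical step

  -- ψ and −φ are the roots of T² + 4T − 1.
  quadratic-nonneg : ∀ {t D} → NonNeg D → ψ * D ≤ t → NonNeg (t * t + ι 4 * t * D - D * D)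
  quadratic-nonneg {t} {D} 0≤D (mk≤ 0≤t-ψD) = subst NonNeg (factor t D) (NonNeg-* 0≤t-ψD 0≤t+φD)
    where
    factor : ∀ t D → (t - ψ * D) * (t + φ * D) ≡ t * t + ι 4 * t * D - D * D
    factor = solve-∀ ring
    shift : ∀ t D → (t - ψ * D) + ι 2 * √5 * D ≡ t + φ * D
    shift = solve-∀ ring
    0≤t+φD : NonNeg (t + φ * D)
    0≤t+φD = subst NonNeg (shift t D) (NonNeg-+ 0≤t-ψD (NonNeg-* (NonNeg-* (NonNeg-ι 2) NonNeg-√5) 0≤D))

  -- For X = Y = Z = t and x = D/t: (1 + x)³ ≤ 8x² when x ≥ 1 and 1 + 4x − x² ≥ 0, as the
  -- difference is (x − 1)(1 + 4x − x²).
  cubic-bound : ∀ {t D X Y Z} → NonNeg D → NonNeg X → NonNeg Y → X ≤ t → Y ≤ t → Z ≤ t → t ≤ D →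
                NonNeg (t * t + ι 4 * t * D - D * D) → (D + X) * (D + Y) * (D + Z) ≤ ι 8 * t * D * D
  cubic-bound {t} {D} {X} {Y} {Z} 0≤D 0≤X 0≤Y X≤t@(mk≤ 0≤t-X) (mk≤ 0≤t-Y) (mk≤ 0≤t-Z) (mk≤ 0≤D-t) 0≤q =
    mk≤ (subst NonNeg (sym (expand t D X Y Z))
      (NonNeg-+ (NonNeg-+ (NonNeg-+ (NonNeg-* 0≤D-t 0≤q) (NonNeg-* (NonNeg-* 0≤t-X 0≤D+t) 0≤D+t))
                          (NonNeg-* (NonNeg-* 0≤D+X 0≤t-Y) 0≤D+t))
                (NonNeg-* (NonNeg-* 0≤D+X 0≤D+Y) 0≤t-Z)))
    where
    expand : ∀ t D X Y Z → ι 8 * t * D * D - (D + X) * (D + Y) * (D + Z)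
                         ≡ (D - t) * (t * t + ι 4 * t * D - D * D) + (t - X) * (D + t) * (D + t)
                           + (D + X) * (t - Y) * (D + t) + (D + X) * (D + Y) * (t - Z)
    expand = solve-∀ ring
    0≤D+t : NonNeg (D + t)
    0≤D+t = NonNeg-+ 0≤D (NonNeg-mono X≤t 0≤X)
    0≤D+X : NonNeg (D + X)
    0≤D+X = NonNeg-+ 0≤D 0≤X
    0≤D+Y : NonNeg (D + Y)
    0≤D+Y = NonNeg-+ 0≤D 0≤Y

  private
    ≤-8*-trans : ∀ {D P t} → P ℕ.≤ 8 ℕ.* D → ι D ≤ t → ι P ≤ ι 8 * t
    ≤-8*-trans {D} {P} {t} P≤8D D≤t = begin
      ι P          ≤⟨ ι-mono-≤ P≤8D ⟩
      ι (8 ℕ.* D)  ≡⟨ ι-* 8 D ⟩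
      ι 8 * ι D    ≤⟨ *-monoˡ-≤ (NonNeg-ι 8) D≤t ⟩
      ι 8 * t      ∎
      where open ≤-Reasoning

  product-bound : ∀ {D X Y Z P t} → D ℕ.* D ℕ.* P ≡ (D ℕ.+ X) ℕ.* (D ℕ.+ Y) ℕ.* (D ℕ.+ Z) → P ℕ.≤ 8 ℕ.* D →
                ι X ≤ t → ι Y ≤ t → ι Z ≤ t → ψ * ι D ≤ t → ι P ≤ ι 8 * t
  product-bound {zero} {X} _ P≤8D X≤t _ _ _ = ≤-8*-trans P≤8D (≤-trans (ι-mono-≤ {0} {X} z≤n) X≤t)
  product-bound {D@(suc k)} {X} {Y} {Z} {P} {t} D²P≡ P≤8D X≤t Y≤t Z≤t ψD≤t = by-cases (≤-total (ι D) t)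
    where
    open ≤-Reasoning
    ι-product : ι ((D ℕ.+ X) ℕ.* (D ℕ.+ Y) ℕ.* (D ℕ.+ Z)) ≡ (ι D + ι X) * (ι D + ι Y) * (ι D + ι Z)
    ι-product = trans (ι-* ((D ℕ.+ X) ℕ.* (D ℕ.+ Y)) (D ℕ.+ Z))
                  (cong₂ _*_ (trans (ι-* (D ℕ.+ X) (D ℕ.+ Y)) (cong₂ _*_ (ι-+ D X) (ι-+ D Y))) (ι-+ D Z))
    rearrange : ∀ s d → s * d * d ≡ d * d * s
    rearrange = solve-∀ ring
    by-cases : ι D ≤ t ⊎ t ≤ ι D → ι P ≤ ι 8 * t
    by-cases (inj₁ D≤t) = ≤-8*-trans P≤8D D≤t
    by-cases (inj₂ t≤D) = *-cancelˡ-≤ (k ℕ.+ k ℕ.* D) {ι P} {ι 8 * t} (begin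
      ι (D ℕ.* D) * ι P                              ≡⟨ ι-* (D ℕ.* D) P ⟨
      ι (D ℕ.* D ℕ.* P)                              ≡⟨ cong ι D²P≡ ⟩
      ι ((D ℕ.+ X) ℕ.* (D ℕ.+ Y) ℕ.* (D ℕ.+ Z))      ≡⟨ ι-product ⟩
      (ι D + ι X) * (ι D + ι Y) * (ι D + ι Z)        ≤⟨ cubic-bound {t} {ι D} {ι X} {ι Y} {ι Z}
                                                          (NonNeg-ι D) (NonNeg-ι X) (NonNeg-ι Y) X≤t Y≤t Z≤t t≤D
                                                          (quadratic-nonneg {t} {ι D} (NonNeg-ι D) ψD≤t) ⟩
      ι 8 * t * ι D * ι D                            ≡⟨ rearrange (ι 8 * t) (ι D) ⟩
      ι D * ι D * (ι 8 * t)                          ≡⟨ cong (_* (ι 8 * t)) (ι-* D D) ⟨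
      ι (D ℕ.* D) * (ι 8 * t)                        ∎)

  private
    halves-≤ : ∀ {a a′ b b′ c c′} → a′ ℕ.≤ a → b′ ℕ.≤ b → c′ ℕ.≤ c →
               (a ℕ.+ a′) ℕ.* (b ℕ.+ b′) ℕ.* (c ℕ.+ c′) ℕ.≤ 8 ℕ.* (a ℕ.* b ℕ.* c)
    halves-≤ {a} {a′} {b} {b′} {c} {c′} a′≤a b′≤b c′≤c = begin
      (a ℕ.+ a′) ℕ.* (b ℕ.+ b′) ℕ.* (c ℕ.+ c′)
        ≤⟨ ℕ.*-mono-≤ (ℕ.*-mono-≤ (ℕ.+-monoʳ-≤ a a′≤a) (ℕ.+-monoʳ-≤ b b′≤b)) (ℕ.+-monoʳ-≤ c c′≤c) ⟩
      (a ℕ.+ a) ℕ.* (b ℕ.+ b) ℕ.* (c ℕ.+ c)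
        ≡⟨ ℕ-Solver.solve (a ∷ b ∷ c ∷ []) ⟩
      8 ℕ.* (a ℕ.* b ℕ.* c) ∎
      where open ℕ.≤-Reasoning

    halves-product : ∀ a a′ b b′ c c′ →
      a ℕ.* b ℕ.* c ℕ.* (a ℕ.* b ℕ.* c) ℕ.* ((a ℕ.+ a′) ℕ.* (b ℕ.+ b′) ℕ.* (c ℕ.+ c′))
      ≡ (a ℕ.* b ℕ.* c ℕ.+ a′ ℕ.* b ℕ.* c) ℕ.* (a ℕ.* b ℕ.* c ℕ.+ a ℕ.* b′ ℕ.* c)
        ℕ.* (a ℕ.* b ℕ.* c ℕ.+ a ℕ.* b ℕ.* c′)
    halves-product = ℕ-Solver.solve-∀

    8[8u³]≡8[2u]³ : ∀ u → 8 ℕ.* (8 ℕ.* u ℕ.^ 3) ≡ 8 ℕ.* (2 ℕ.* u) ℕ.^ 3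
    8[8u³]≡8[2u]³ = unfolded
      where
      unfolded : ∀ u → 8 ℕ.* (8 ℕ.* (u ℕ.* (u ℕ.* (u ℕ.* 1))))
                     ≡ 8 ℕ.* (2 ℕ.* u ℕ.* (2 ℕ.* u ℕ.* (2 ℕ.* u ℕ.* 1)))
      unfolded = ℕ-Solver.solve-∀

  -- p ≲⟨ r ⟩ N means φʳ p ≤ 8N³.
  infix 4 _≲⟨_⟩_
  record _≲⟨_⟩_ (p r N : ℕ) : Set where
    constructor mk≲
    field
      ≲⇒≤ : ι p ≤ ψ ^ r * ι (8 ℕ.* N ℕ.^ 3)

  private
    ι8-absorb : ∀ s u → ι 8 * (s * ι (8 ℕ.* u ℕ.^ 3)) ≡ s * ι (8 ℕ.* (2 ℕ.* u) ℕ.^ 3)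
    ι8-absorb s u = begin
      ι 8 * (s * ι (8 ℕ.* u ℕ.^ 3))          ≡⟨ swap (ι 8) s (ι (8 ℕ.* u ℕ.^ 3)) ⟩
      s * (ι 8 * ι (8 ℕ.* u ℕ.^ 3))          ≡⟨ cong (s *_) (ι-* 8 (8 ℕ.* u ℕ.^ 3)) ⟨
      s * ι (8 ℕ.* (8 ℕ.* u ℕ.^ 3))          ≡⟨ cong (λ n → s * ι n) (8[8u³]≡8[2u]³ u) ⟩
      s * ι (8 ℕ.* (2 ℕ.* u) ℕ.^ 3)          ∎
      where
      open ≡-Reasoning
      swap : ∀ a b c → a * (b * c) ≡ b * (a * c)
      swap = solve-∀ ring

  ≲-zero : ∀ {r N} → 0 ≲⟨ r ⟩ N
  ≲-zero {r} {N} =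
    mk≲ (mk≤ (subst NonNeg (sym (+-identityʳ _)) (NonNeg-* (NonNeg-^ r NonNeg-ψ) (NonNeg-ι (8 ℕ.* N ℕ.^ 3)))))

  ≲-mono : ∀ {p r N N′} → N ℕ.≤ N′ → p ≲⟨ r ⟩ N → p ≲⟨ r ⟩ N′
  ≲-mono {r = r} N≤N′ (mk≲ p≤) =
    mk≲ (≤-trans p≤ (*-monoˡ-≤ (NonNeg-^ r NonNeg-ψ) (ι-mono-≤ (ℕ.*-monoʳ-≤ 8 (ℕ.^-monoˡ-≤ 3 N≤N′)))))

  ≲⟨0⟩ : ∀ {p N} → p ℕ.≤ 8 ℕ.* N ℕ.^ 3 → p ≲⟨ 0 ⟩ N
  ≲⟨0⟩ p≤8N³ = mk≲ (≤-trans (ι-mono-≤ p≤8N³) (≤-reflexive (sym (*-identityˡ _))))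

  ≲-double : ∀ {r u a a′ b b′ c c′} → a′ ℕ.≤ a → b′ ℕ.≤ b → c′ ℕ.≤ c →
             a ℕ.* b ℕ.* c ≲⟨ r ⟩ u → (a ℕ.+ a′) ℕ.* (b ℕ.+ b′) ℕ.* (c ℕ.+ c′) ≲⟨ r ⟩ (2 ℕ.* u)
  ≲-double {r} {u} {a} {a′} {b} {b′} {c} {c′} a′≤a b′≤b c′≤c (mk≲ D≤) = mk≲ $ begin
    ι ((a ℕ.+ a′) ℕ.* (b ℕ.+ b′) ℕ.* (c ℕ.+ c′))  ≤⟨ ι-mono-≤ (halves-≤ a′≤a b′≤b c′≤c) ⟩
    ι (8 ℕ.* (a ℕ.* b ℕ.* c))                    ≡⟨ ι-* 8 (a ℕ.* b ℕ.* c) ⟩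
    ι 8 * ι (a ℕ.* b ℕ.* c)                      ≤⟨ *-monoˡ-≤ (NonNeg-ι 8) D≤ ⟩
    ι 8 * (ψ ^ r * ι (8 ℕ.* u ℕ.^ 3))            ≡⟨ ι8-absorb (ψ ^ r) u ⟩
    ψ ^ r * ι (8 ℕ.* (2 ℕ.* u) ℕ.^ 3)            ∎
    where open ≤-Reasoning

  ≲-step : ∀ {r v a a′ b b′ c c′} → a′ ℕ.≤ a → b′ ℕ.≤ b → c′ ℕ.≤ c →
           a′ ℕ.* b ℕ.* c ≲⟨ suc r ⟩ v → a ℕ.* b′ ℕ.* c ≲⟨ suc r ⟩ v → a ℕ.* b ℕ.* c′ ≲⟨ suc r ⟩ v →
           a ℕ.* b ℕ.* c ≲⟨ r ⟩ v → (a ℕ.+ a′) ℕ.* (b ℕ.+ b′) ℕ.* (c ℕ.+ c′) ≲⟨ suc r ⟩ (2 ℕ.* v)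
  ≲-step {r} {v} {a} {a′} {b} {b′} {c} {c′} a′≤a b′≤b c′≤c (mk≲ X≤) (mk≲ Y≤) (mk≲ Z≤) (mk≲ D≤) =
    mk≲ $ begin
    ι ((a ℕ.+ a′) ℕ.* (b ℕ.+ b′) ℕ.* (c ℕ.+ c′))
      ≤⟨ product-bound {a ℕ.* b ℕ.* c} {a′ ℕ.* b ℕ.* c} {a ℕ.* b′ ℕ.* c} {a ℕ.* b ℕ.* c′}
           (halves-product a a′ b b′ c c′) (halves-≤ a′≤a b′≤b c′≤c) X≤ Y≤ Z≤ ψD≤ ⟩
    ι 8 * (ψ ^ suc r * ι (8 ℕ.* v ℕ.^ 3))        ≡⟨ ι8-absorb (ψ ^ suc r) v ⟩
    ψ ^ suc r * ι (8 ℕ.* (2 ℕ.* v) ℕ.^ 3)        ∎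
    where
    open ≤-Reasoning
    ψD≤ : ψ * ι (a ℕ.* b ℕ.* c) ≤ ψ ^ suc r * ι (8 ℕ.* v ℕ.^ 3)
    ψD≤ = ≤-trans (*-monoˡ-≤ NonNeg-ψ D≤) (≤-reflexive (sym (*-assoc ψ (ψ ^ r) _)))

  φ^-components : ∀ r → φ ^ r ≡ ι (proj₁ (pow2√5 r)) + ι (proj₂ (pow2√5 r)) * √5
  φ^-components zero = refl
  φ^-components (suc r) = begin
    φ * φ ^ r                                          ≡⟨ cong (φ *_) (φ^-components r) ⟩
    φ * (ι a + ι b * √5)                               ≡⟨ expand (ι a) (ι b) ⟩
    (ι 2 * ι a + ι 5 * ι b) + (ι a + ι 2 * ι b) * √5   ≡⟨ cong₂ (λ x y → x + y * √5) ι-re ι-im ⟨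
    ι (2 ℕ.* a ℕ.+ 5 ℕ.* b) + ι (a ℕ.+ 2 ℕ.* b) * √5   ∎
    where
    open ≡-Reasoning
    a b : ℕ
    a = proj₁ (pow2√5 r)
    b = proj₂ (pow2√5 r)
    expand : ∀ x y → φ * (x + y * √5) ≡ (ι 2 * x + ι 5 * y) + (x + ι 2 * y) * √5
    expand = solve-∀ ring
    ι-re : ι (2 ℕ.* a ℕ.+ 5 ℕ.* b) ≡ ι 2 * ι a + ι 5 * ι b
    ι-re = trans (ι-+ (2 ℕ.* a) (5 ℕ.* b)) (cong₂ _+_ (ι-* 2 a) (ι-* 5 b))
    ι-im : ι (a ℕ.+ 2 ℕ.* b) ≡ ι a + ι 2 * ι b
    ι-im = trans (ι-+ a (2 ℕ.* b)) (cong (_+_ (ι a)) (ι-* 2 b))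

  φ^*ψ^ : ∀ r → φ ^ r * ψ ^ r ≡ 1#
  φ^*ψ^ zero = refl
  φ^*ψ^ (suc r) = trans (regroup (φ ^ r) (ψ ^ r)) (φ^*ψ^ r)
    where
    regroup : ∀ x y → φ * x * (ψ * y) ≡ x * y
    regroup = solve-∀ ring

  √5≤-of-≤ : ∀ {a b N} → ι a + ι b * √5 ≤ ι N → a + b √5≤ N
  √5≤-of-≤ {a} {b} {N} a+b√5≤N = a≤N , ι-cancel-≤ (begin
    ι (5 ℕ.* b ℕ.* b)                  ≡⟨ ι-5bb ⟩
    ι b * √5 * (ι b * √5)              ≤⟨ square-mono-≤ 0≤b√5 b√5≤N-a ⟩
    ι (N ℕ.∸ a) * ι (N ℕ.∸ a)          ≡⟨ ι-* (N ℕ.∸ a) (N ℕ.∸ a) ⟨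
    ι ((N ℕ.∸ a) ℕ.* (N ℕ.∸ a))        ∎)
    where
    open ≤-Reasoning
    0≤b√5 : NonNeg (ι b * √5)
    0≤b√5 = NonNeg-* (NonNeg-ι b) NonNeg-√5
    a≤N : a ℕ.≤ N
    a≤N = ι-cancel-≤ (≤-trans (mk≤ (subst NonNeg (cancel (ι a) (ι b * √5)) 0≤b√5)) a+b√5≤N)
      where
      cancel : ∀ x y → y ≡ x + y - x
      cancel = solve-∀ ring
    b√5≤N-a : ι b * √5 ≤ ι (N ℕ.∸ a)
    b√5≤N-a = mk≤ (subst NonNeg
      (trans (cong (_- (ι a + ι b * √5)) ιN≡) (cancel (ι (N ℕ.∸ a)) (ι a) (ι b * √5))) (diff-nonneg a+b√5≤N))
      where
      ιN≡ : ι N ≡ ι (N ℕ.∸ a) + ι a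
      ιN≡ = trans (cong ι (sym (ℕ.m∸n+n≡m a≤N))) (ι-+ (N ℕ.∸ a) a)
      cancel : ∀ d x y → d + x - (x + y) ≡ d - y
      cancel = solve-∀ ring
    ι-5bb : ι (5 ℕ.* b ℕ.* b) ≡ ι b * √5 * (ι b * √5)
    ι-5bb = trans (trans (ι-* (5 ℕ.* b) b) (cong (_* ι b) (ι-* 5 b))) (squares (ι b))
      where
      squares : ∀ x → ι 5 * x * x ≡ x * √5 * (x * √5)
      squares = solve-∀ ring

  ≲⇒√5≤ : ∀ {r p N} → p ≲⟨ r ⟩ N →
          (proj₁ (pow2√5 r) ℕ.* p) + (proj₂ (pow2√5 r) ℕ.* p) √5≤ (8 ℕ.* N ℕ.^ 3)
  ≲⇒√5≤ {r} {p} {N} (mk≲ p≤) = √5≤-of-≤ {α ℕ.* p} {β ℕ.* p} {M} (begin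
    ι (α ℕ.* p) + ι (β ℕ.* p) * √5          ≡⟨ cong₂ (λ x y → x + y * √5) (ι-* α p) (ι-* β p) ⟩
    ι α * ι p + ι β * ι p * √5              ≡⟨ factor (ι α) (ι β) (ι p) ⟩
    (ι α + ι β * √5) * ι p                  ≡⟨ cong (_* ι p) (φ^-components r) ⟨
    φ ^ r * ι p                             ≤⟨ *-monoˡ-≤ (NonNeg-^ r NonNeg-φ) p≤ ⟩
    φ ^ r * (ψ ^ r * ι M)                   ≡⟨ *-assoc (φ ^ r) (ψ ^ r) (ι M) ⟨
    φ ^ r * ψ ^ r * ι M                     ≡⟨ cong (_* ι M) (φ^*ψ^ r) ⟩
    1# * ι M                                ≡⟨ *-identityˡ (ι M) ⟩
    ι M                                     ∎)
    where
    open ≤-Reasoning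
    α β M : ℕ
    α = proj₁ (pow2√5 r)
    β = proj₂ (pow2√5 r)
    M = 8 ℕ.* N ℕ.^ 3
    factor : ∀ x y z → x * z + y * z * √5 ≡ (x + y * √5) * z
    factor = solve-∀ ring

open ℤ[√5] using (_≲⟨_⟩_; ≲-zero; ≲-mono; ≲⟨0⟩; ≲-double; ≲-step; ≲⇒√5≤)

open import Data.Bool.Base using (Bool; true; false; not; _xor_; T)
open import Data.Bool.Properties using (T-∧; xor-comm; xor-identityʳ; true-xor; not-distribˡ-xor; not-distribʳ-xor)
open import Data.List.Base using ([]; _∷_; map; _++_; length; filterᵇ)
open import Data.List.Membership.Propositional using (_∈_; lose)
open import Data.List.Membership.Propositional.Properties using (∈-++⁺ˡ; ∈-++⁺ʳ; ∈-map⁺)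
open import Data.List.Properties using (length-++; length-map; length-filter; filter-++; filter-none)
open import Data.List.Relation.Binary.Sublist.Propositional using (⊆-refl)
open import Data.List.Relation.Binary.Sublist.Propositional.Properties using (filter⁺)
open import Data.List.Relation.Binary.Sublist.Heterogeneous.Properties using (length-mono-≤)
open import Data.List.Relation.Unary.All.Properties using (¬Any⇒All¬)
open import Data.List.Relation.Unary.Any using (here; any?; satisfied)
open import Data.List.Relation.Unary.Any.Properties using (any⁺; any⁻)
open import Data.Nat.Base using (ℕ; zero; suc; _+_; _*_; _^_; _≤_; z≤n; s≤s)
open import Data.Nat.Properties as ℕ using (≤-refl; ≤-trans; +-mono-≤; *-mono-≤)
open import Data.Product.Base using (∃-syntax; _×_; _,_; proj₁; proj₂)
open import Data.Sum.Base using (_⊎_; inj₁; inj₂; map₂)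
open import Data.Vec.Base using ([]; _∷_; replicate)
open import Data.Vec.Properties using (zipWith-comm)
import Data.Nat.Tactic.RingSolver as ℕ-Solver
open import Function.Base using (_∘_)
open import Function.Bundles using (Equivalence)
open import Relation.Binary.PropositionalEquality
open import Relation.Nullary.Decidable using (yes; no; T?)

private
  variable
    n : ℕ

-- Sumsets in F₂ⁿ

slice : Subset2 (suc n) → Bool → Subset2 n
slice X b v = X (b ∷ v)

infix 4 _⊆_
_⊆_ : Subset2 n → Subset2 n → Set
X ⊆ Y = ∀ v → T (X v) → T (Y v)

length-allVecs : ∀ n → length (allVecs n) ≡ 2 ^ n
length-allVecs zero = refl
length-allVecs (suc n) = begin
  length (map (true ∷_) (allVecs n) ++ map (false ∷_) (allVecs n))  ≡⟨ length-++ (map (true ∷_) (allVecs n)) ⟩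
  length (map (true ∷_) (allVecs n)) + length (map (false ∷_) (allVecs n))
    ≡⟨ cong₂ _+_ (length-map (true ∷_) (allVecs n)) (length-map (false ∷_) (allVecs n)) ⟩
  length (allVecs n) + length (allVecs n)  ≡⟨ cong (λ k → k + k) (length-allVecs n) ⟩
  2 ^ n + 2 ^ n                            ≡⟨ cong (2 ^ n +_) (ℕ.+-identityʳ (2 ^ n)) ⟨
  2 ^ suc n                                ∎
  where open ≡-Reasoning

∈-allVecs : (v : F2 n) → v ∈ allVecs n
∈-allVecs [] = here refl
∈-allVecs (true ∷ v) = ∈-++⁺ˡ (∈-map⁺ (true ∷_) (∈-allVecs v))
∈-allVecs {suc n} (false ∷ v) = ∈-++⁺ʳ (map (true ∷_) (allVecs n)) (∈-map⁺ (false ∷_) (∈-allVecs v))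

card≤2^n : (X : Subset2 n) → card X ≤ 2 ^ n
card≤2^n {n} X = subst (card X ≤_) (length-allVecs n) (length-filter (T? ∘ X) (allVecs n))

card-mono : {X Y : Subset2 n} → X ⊆ Y → card X ≤ card Y
card-mono {n} {X} {Y} X⊆Y =
  length-mono-≤ (filter⁺ (T? ∘ X) (T? ∘ Y) (λ { {v} refl → X⊆Y v }) (⊆-refl {x = allVecs n}))

length-filterᵇ-map : ∀ {A B : Set} (p : B → Bool) (f : A → B) xs →
                     length (filterᵇ p (map f xs)) ≡ length (filterᵇ (p ∘ f) xs)
length-filterᵇ-map p f [] = refl
length-filterᵇ-map p f (x ∷ xs) with p (f x)
... | true = cong suc (length-filterᵇ-map p f xs)
... | false = length-filterᵇ-map p f xs

card-split : (X : Subset2 (suc n)) (i : Bool) → card X ≡ card (slice X i) + card (slice X (not i))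
card-split {n} X true = begin
  length (filterᵇ X (map (true ∷_) (allVecs n) ++ map (false ∷_) (allVecs n)))
    ≡⟨ cong length (filter-++ (T? ∘ X) (map (true ∷_) (allVecs n)) _) ⟩
  length (filterᵇ X (map (true ∷_) (allVecs n)) ++ filterᵇ X (map (false ∷_) (allVecs n)))
    ≡⟨ length-++ (filterᵇ X (map (true ∷_) (allVecs n))) ⟩
  length (filterᵇ X (map (true ∷_) (allVecs n))) + length (filterᵇ X (map (false ∷_) (allVecs n)))
    ≡⟨ cong₂ _+_ (length-filterᵇ-map X (true ∷_) (allVecs n)) (length-filterᵇ-map X (false ∷_) (allVecs n)) ⟩
  card (slice X true) + card (slice X false) ∎
  where open ≡-Reasoning
card-split X false = trans (card-split X true) (ℕ.+-comm (card (slice X true)) _)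

empty-or-inhabited : (X : Subset2 n) → card X ≡ 0 ⊎ ∃[ v ] T (X v)
empty-or-inhabited {n} X with any? (T? ∘ X) (allVecs n)
... | yes inhabited = inj₂ (satisfied inhabited)
... | no empty = inj₁ (cong length (filter-none (T? ∘ X) (¬Any⇒All¬ (allVecs n) empty)))

eqᵇ-refl : (v : F2 n) → T (eqᵇ v v)
eqᵇ-refl [] = _
eqᵇ-refl (true ∷ v) = eqᵇ-refl v
eqᵇ-refl (false ∷ v) = eqᵇ-refl v

eqᵇ-sound : (u v : F2 n) → T (eqᵇ u v) → u ≡ v
eqᵇ-sound [] [] _ = refl
eqᵇ-sound (true ∷ u) (true ∷ v) u≡v = cong (true ∷_) (eqᵇ-sound u v u≡v)
eqᵇ-sound (false ∷ u) (false ∷ v) u≡v = cong (false ∷_) (eqᵇ-sound u v u≡v)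

⊕-comm : (x y : F2 n) → x ⊕ y ≡ y ⊕ x
⊕-comm = zipWith-comm xor-comm

+ˢ-intro : (X Y : Subset2 n) (x y : F2 n) → T (X x) → T (Y y) → T ((X +ˢ Y) (x ⊕ y))
+ˢ-intro X Y x y x∈X y∈Y =
  any⁺ _ (lose (∈-allVecs x) (any⁺ _ (lose (∈-allVecs y)
    (Equivalence.from T-∧ (x∈X , Equivalence.from T-∧ (y∈Y , eqᵇ-refl (x ⊕ y)))))))

+ˢ-elim : (X Y : Subset2 n) (v : F2 n) → T ((X +ˢ Y) v) → ∃[ x ] ∃[ y ] T (X x) × T (Y y) × x ⊕ y ≡ v
+ˢ-elim {n} X Y v v∈X+Y with satisfied (any⁻ _ (allVecs n) v∈X+Y)
... | x , h with satisfied (any⁻ _ (allVecs n) h)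
... | y , h′ with Equivalence.to T-∧ h′
... | x∈X , h″ with Equivalence.to T-∧ h″
... | y∈Y , x⊕y≡v = x , y , x∈X , y∈Y , eqᵇ-sound (x ⊕ y) v x⊕y≡v

card-≤-translate : {X Y : Subset2 n} (w : F2 n) → (∀ {x} → T (X x) → T (Y (x ⊕ w))) → card X ≤ card Y
card-≤-translate {zero} {X} {Y} [] X+w⊆Y = card-mono {X = X} {Y} λ { [] → X+w⊆Y }
card-≤-translate {suc n} {X} {Y} (false ∷ w) X+w⊆Y =
  subst₂ _≤_ (sym (card-split X true)) (sym (card-split Y true))
    (+-mono-≤ (card-≤-translate w X+w⊆Y) (card-≤-translate w X+w⊆Y))
card-≤-translate {suc n} {X} {Y} (true ∷ w) X+w⊆Y =
  subst₂ _≤_ (sym (card-split X true)) (sym (card-split Y false))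
    (+-mono-≤ (card-≤-translate w X+w⊆Y) (card-≤-translate w X+w⊆Y))

card-≤-+ˢˡ : (X Y : Subset2 n) (y : F2 n) → T (Y y) → card X ≤ card (X +ˢ Y)
card-≤-+ˢˡ X Y y y∈Y = card-≤-translate y λ {x} x∈X → +ˢ-intro X Y x y x∈X y∈Y

card-≤-+ˢʳ : (X Y : Subset2 n) (x : F2 n) → T (X x) → card Y ≤ card (X +ˢ Y)
card-≤-+ˢʳ X Y x x∈X = card-≤-translate x λ {y} y∈Y →
  subst (T ∘ (X +ˢ Y)) (⊕-comm x y) (+ˢ-intro X Y x y x∈X y∈Y)

H-slice-false : ∀ n {ρ r} → ρ ≤ r → H n ρ ⊆ slice (H (suc n) r) false
H-slice-false n {ρ} ρ≤r v v∈H = ℕ.≤⇒≤ᵇ (≤-trans (ℕ.≤ᵇ⇒≤ (norm v) ρ v∈H) ρ≤r)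

H-slice-true : ∀ n {ρ r} → suc ρ ≤ r → H n ρ ⊆ slice (H (suc n) r) true
H-slice-true n {ρ} ρ<r v v∈H = ℕ.≤⇒≤ᵇ (≤-trans (s≤s (ℕ.≤ᵇ⇒≤ (norm v) ρ v∈H)) ρ<r)

0∈H : ∀ n r → T (H n r (replicate n false))
0∈H zero r = _
0∈H (suc n) r = 0∈H n r

S : ∀ n → ℕ → (A A′ A″ : Subset2 n) → Subset2 n
S n r A A′ A″ = ((A +ˢ A′) +ˢ A″) +ˢ H n r

S-slice : ∀ {ρ r} (A A′ A″ : Subset2 (suc n)) (i j k c : Bool) {m : Bool} → ((i xor j) xor k) xor c ≡ m →
          H n ρ ⊆ slice (H (suc n) r) c →
          S n ρ (slice A i) (slice A′ j) (slice A″ k) ⊆ slice (S (suc n) r A A′ A″) m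
S-slice {n} {ρ} {r} A A′ A″ i j k c refl H⊆ v v∈S
  with +ˢ-elim ((slice A i +ˢ slice A′ j) +ˢ slice A″ k) (H n ρ) v v∈S
... | s , h , s∈ , h∈H , refl with +ˢ-elim (slice A i +ˢ slice A′ j) (slice A″ k) s s∈
... | s′ , z , s′∈ , z∈A″ , refl with +ˢ-elim (slice A i) (slice A′ j) s′ s′∈
... | x , y , x∈A , y∈A′ , refl =
  +ˢ-intro ((A +ˢ A′) +ˢ A″) (H (suc n) r) (((i ∷ x) ⊕ (j ∷ y)) ⊕ (k ∷ z)) (c ∷ h)
    (+ˢ-intro (A +ˢ A′) A″ ((i ∷ x) ⊕ (j ∷ y)) (k ∷ z) (+ˢ-intro A A′ (i ∷ x) (j ∷ y) x∈A y∈A′) z∈A″)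
    (H⊆ h h∈H)

card-product≤card-S³ : ∀ r (A A′ A″ : Subset2 n) → card A * card A′ * card A″ ≤ card (S n r A A′ A″) ^ 3
card-product≤card-S³ {n} r A A′ A″
  with empty-or-inhabited A | empty-or-inhabited A′ | empty-or-inhabited A″
... | inj₁ |A|≡0 | _ | _ rewrite |A|≡0 = z≤n
... | inj₂ _ | inj₁ |A′|≡0 | _ rewrite |A′|≡0 | ℕ.*-zeroʳ (card A) = z≤n
... | inj₂ _ | inj₂ _ | inj₁ |A″|≡0 rewrite |A″|≡0 | ℕ.*-zeroʳ (card A * card A′) = z≤n
... | inj₂ (x , x∈A) | inj₂ (y , y∈A′) | inj₂ (z , z∈A″) =
  subst (card A * card A′ * card A″ ≤_) (cube (card (S n r A A′ A″)))
    (*-mono-≤ (*-mono-≤ |A|≤|S| |A′|≤|S|) |A″|≤|S|)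
  where
  cube : ∀ N → N * N * N ≡ N * (N * (N * 1))
  cube = ℕ-Solver.solve-∀
  A+A′+A″≤S : card ((A +ˢ A′) +ˢ A″) ≤ card (S n r A A′ A″)
  A+A′+A″≤S = card-≤-+ˢˡ ((A +ˢ A′) +ˢ A″) (H n r) (replicate n false) (0∈H n r)
  A+A′≤S : card (A +ˢ A′) ≤ card (S n r A A′ A″)
  A+A′≤S = ≤-trans (card-≤-+ˢˡ (A +ˢ A′) A″ z z∈A″) A+A′+A″≤S
  |A|≤|S| : card A ≤ card (S n r A A′ A″)
  |A|≤|S| = ≤-trans (card-≤-+ˢˡ A A′ y y∈A′) A+A′≤S
  |A′|≤|S| : card A′ ≤ card (S n r A A′ A″)
  |A′|≤|S| = ≤-trans (card-≤-+ˢʳ A A′ x x∈A) A+A′≤S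
  |A″|≤|S| : card A″ ≤ card (S n r A A′ A″)
  |A″|≤|S| = ≤-trans (card-≤-+ˢʳ (A +ˢ A′) A″ (x ⊕ y) (+ˢ-intro A A′ x y x∈A y∈A′)) A+A′+A″≤S

-- Induction on the dimension

Estimate : ℕ → ℕ → ℕ → ℕ → Set
Estimate n r p N = 2 ^ n ≤ N ⊎ p ≲⟨ r ⟩ N

Estimate-mono : ∀ {r p N N′} → N ≤ N′ → Estimate n r p N → Estimate n r p N′
Estimate-mono N≤N′ (inj₁ 2ⁿ≤N) = inj₁ (≤-trans 2ⁿ≤N N≤N′)
Estimate-mono N≤N′ (inj₂ p≲N) = inj₂ (≲-mono N≤N′ p≲N)

private
  double≤+ˡ : ∀ {u v} → u ≤ v → 2 * u ≤ u + v
  double≤+ˡ {u} u≤v = ℕ.+-monoʳ-≤ u (subst (_≤ _) (sym (ℕ.+-identityʳ u)) u≤v)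

  double≤+ʳ : ∀ {u v} → v ≤ u → 2 * v ≤ u + v
  double≤+ʳ {u} {v} v≤u = subst (2 * v ≤_) (ℕ.+-comm v u) (double≤+ˡ v≤u)

Estimate-halves : ∀ {r p u v} → u ≤ 2 ^ n → v ≤ 2 ^ n →
                  2 ^ n ≤ u ⊎ p ≲⟨ r ⟩ (2 * u) → 2 ^ n ≤ v ⊎ p ≲⟨ r ⟩ (2 * v) → Estimate (suc n) r p (u + v)
Estimate-halves {n} {u = u} {v} _ _ (inj₁ 2ⁿ≤u) (inj₁ 2ⁿ≤v) =
  inj₁ (subst (_≤ u + v) (cong (2 ^ n +_) (sym (ℕ.+-identityʳ (2 ^ n)))) (+-mono-≤ 2ⁿ≤u 2ⁿ≤v))
Estimate-halves _ v≤2ⁿ (inj₁ 2ⁿ≤u) (inj₂ p≲2v) = inj₂ (≲-mono (double≤+ʳ (≤-trans v≤2ⁿ 2ⁿ≤u)) p≲2v)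
Estimate-halves u≤2ⁿ _ (inj₂ p≲2u) (inj₁ 2ⁿ≤v) = inj₂ (≲-mono (double≤+ˡ (≤-trans u≤2ⁿ 2ⁿ≤v)) p≲2u)
Estimate-halves {u = u} {v} _ _ (inj₂ p≲2u) (inj₂ p≲2v) with ℕ.≤-total u v
... | inj₁ u≤v = inj₂ (≲-mono (double≤+ˡ u≤v) p≲2u)
... | inj₂ v≤u = inj₂ (≲-mono (double≤+ʳ v≤u) p≲2v)

larger-slice : (X : Subset2 (suc n)) → ∃[ i ] card (slice X (not i)) ≤ card (slice X i)
larger-slice X with ℕ.≤-total (card (slice X false)) (card (slice X true))
... | inj₁ f≤t = true , f≤t
... | inj₂ t≤f = false , t≤f

estimate-step : ∀ {r} → (∀ ρ (B B′ B″ : Subset2 n) → Estimate n ρ (card B * card B′ * card B″) (card (S n ρ B B′ B″))) →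
                (A A′ A″ : Subset2 (suc n)) →
                Estimate (suc n) (suc r) (card A * card A′ * card A″) (card (S (suc n) (suc r) A A′ A″))
estimate-step {n} {r} estimateₙ A A′ A″ with larger-slice A | larger-slice A′ | larger-slice A″
... | i , a′≤a | j , b′≤b | k , c′≤c =
  subst₂ (Estimate (suc n) (suc r)) (sym |A||A′||A″|≡Π) (sym (card-split Sₙ₊₁ m))
    (Estimate-halves {n} (card≤2^n {n} (slice Sₙ₊₁ m)) (card≤2^n {n} (slice Sₙ₊₁ (not m))) lower upper)
  where
  Sₙ₊₁ : Subset2 (suc n)
  Sₙ₊₁ = S (suc n) (suc r) A A′ A″
  m : Bool
  m = (i xor j) xor k
  Π : ℕ
  Π = (card (slice A i) + card (slice A (not i))) * (card (slice A′ j) + card (slice A′ (not j)))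
      * (card (slice A″ k) + card (slice A″ (not k)))

  |A||A′||A″|≡Π : card A * card A′ * card A″ ≡ Π
  |A||A′||A″|≡Π = cong₂ _*_ (cong₂ _*_ (card-split A i) (card-split A′ j)) (card-split A″ k)

  slice-estimate : ∀ ρ i′ j′ k′ c {m′} → ((i′ xor j′) xor k′) xor c ≡ m′ → H n ρ ⊆ slice (H (suc n) (suc r)) c →
                   Estimate n ρ (card (slice A i′) * card (slice A′ j′) * card (slice A″ k′)) (card (slice Sₙ₊₁ m′))
  slice-estimate ρ i′ j′ k′ c m′≡ H⊆ =
    Estimate-mono {n} (card-mono (S-slice A A′ A″ i′ j′ k′ c m′≡ H⊆))
      (estimateₙ ρ (slice A i′) (slice A′ j′) (slice A″ k′))

  H⊆H₀ : H n (suc r) ⊆ slice (H (suc n) (suc r)) false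
  H⊆H₀ = H-slice-false n ≤-refl

  flipᵢ : ((not i xor j) xor k) xor false ≡ not m
  flipᵢ = trans (xor-identityʳ _)
            (trans (cong (_xor k) (sym (not-distribˡ-xor i j))) (sym (not-distribˡ-xor (i xor j) k)))

  flipⱼ : ((i xor not j) xor k) xor false ≡ not m
  flipⱼ = trans (xor-identityʳ _)
            (trans (cong (_xor k) (sym (not-distribʳ-xor i j))) (sym (not-distribˡ-xor (i xor j) k)))

  flipₖ : ((i xor j) xor not k) xor false ≡ not m
  flipₖ = trans (xor-identityʳ _) (sym (not-distribʳ-xor (i xor j) k))

  lower : 2 ^ n ≤ card (slice Sₙ₊₁ m) ⊎ Π ≲⟨ suc r ⟩ (2 * card (slice Sₙ₊₁ m))
  lower with slice-estimate (suc r) i j k false (xor-identityʳ m) H⊆H₀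
  ... | inj₁ full = inj₁ full
  ... | inj₂ abc≲ = inj₂ (≲-double a′≤a b′≤b c′≤c abc≲)

  upper : 2 ^ n ≤ card (slice Sₙ₊₁ (not m)) ⊎ Π ≲⟨ suc r ⟩ (2 * card (slice Sₙ₊₁ (not m)))
  upper with slice-estimate r i j k true (trans (xor-comm m true) (true-xor m)) (H-slice-true n ≤-refl)
           | slice-estimate (suc r) (not i) j k false flipᵢ H⊆H₀
           | slice-estimate (suc r) i (not j) k false flipⱼ H⊆H₀
           | slice-estimate (suc r) i j (not k) false flipₖ H⊆H₀
  ... | inj₁ full | _ | _ | _ = inj₁ full
  ... | _ | inj₁ full | _ | _ = inj₁ full
  ... | _ | _ | inj₁ full | _ = inj₁ full
  ... | _ | _ | _ | inj₁ full = inj₁ full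
  ... | inj₂ abc≲ | inj₂ a′bc≲ | inj₂ ab′c≲ | inj₂ abc′≲ =
    inj₂ (≲-step a′≤a b′≤b c′≤c a′bc≲ ab′c≲ abc′≲ abc≲)

estimate : ∀ n r (A A′ A″ : Subset2 n) → Estimate n r (card A * card A′ * card A″) (card (S n r A A′ A″))
estimate n zero A A′ A″ = inj₂ (≲⟨0⟩ (≤-trans (card-product≤card-S³ 0 A A′ A″) (ℕ.m≤n*m _ 8)))
estimate zero (suc r) A A′ A″ with card (S zero (suc r) A A′ A″) | card-product≤card-S³ (suc r) A A′ A″
... | zero | p≤0 = inj₂ (subst (_≲⟨ suc r ⟩ 0) (sym (ℕ.n≤0⇒n≡0 p≤0)) ≲-zero)
... | suc _ | _ = inj₁ (s≤s z≤n)
estimate (suc n) (suc r) A A′ A″ = estimate-step (estimate n) A A′ A″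

proposition3p4 : (n r : ℕ) (A A' A'' : Subset2 n) →
    (2 ^ n ≤ card (((A +ˢ A') +ˢ A'') +ˢ H n r))
    ⊎ ((proj₁ (pow2√5 r) * (card A * card A' * card A''))
         + (proj₂ (pow2√5 r) * (card A * card A' * card A''))
         √5≤ (8 * (card (((A +ˢ A') +ˢ A'') +ˢ H n r) ^ 3)))
proposition3p4 n r A A' A'' = map₂ ≲⇒√5≤ (estimate n r A A' A'')
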